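{- Let $P$ be a non-empty finite set and $\mathcal{L}$ a set of formulae with semantic function $[\![\cdot]\!]:\mathcal{L}\to\mathcal{P}(P)$ such that $\mathcal{L}(p)\neq\emptyset$ for every $p\in P$, and suppose $\mathcal{L}$ features the Boolean connectives $\wedge$ and $\vee$. Then $\mathcal{L}$ is decomposable.
   Context: For $p\in P$, $\mathcal{L}(p)=\{\phi\in\mathcal{L}\mid p\in[\![\phi]\!]\}$. "$\mathcal{L}$ features $\wedge$ and $\vee$" means that for all $\phi,\psi\in\mathcal{L}$ there are $\phi\wedge\psi,\phi\vee\psi\in\mathcal{L}$ with $[\![\phi\wedge\psi]\!]=[\![\phi]\!]\cap[\![\psi]\!]$ and $[\![\phi\vee\psi]\!]=[\![\phi]\!]\cup[\![\psi]\!]$. A formula is consistent iff its denotation is non-empty. A formula $\chi(p)$ is characteristic for $p$ iff for all $q\in P$: $q\in[\![\chi(p)]\!]$ iff $\mathcal{L}(p)\subseteq\mathcal{L}(q)$. A formula $\phi$ is decomposable iff $[\![\phi]\!]=[\![\chi(p)]\!]\cup[\![\psi_p]\!]$ for some $p\in P$ having a characteristic formula $\chi(p)$ and some $\psi_p\in\mathcal{L}$ with $p\notin[\![\psi_p]\!]$. $\mathcal{L}$ is decomposable iff every consistent formula is decomposable or characteristic for some $p\in P$. -}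

module Defs where

open import Level using (0ℓ)
open import Data.Product using (Σ; ∃; _×_; _,_)
open import Data.Sum using (_⊎_)
open import Relation.Nullary using (¬_)
open import Relation.Unary using (Pred; _∈_; _∉_; _⊆_; _∩_; _∪_; _≐_; Satisfiable)

module _ {P : Set} {L : Set} (⟦_⟧ : L → Pred P 0ℓ) where

  Lof : P → Pred L 0ℓ
  Lof p φ = p ∈ ⟦ φ ⟧

  FeaturesAnd : Set
  FeaturesAnd = (φ ψ : L) → Σ L λ χ → ⟦ χ ⟧ ≐ (⟦ φ ⟧ ∩ ⟦ ψ ⟧)

  FeaturesOr : Set
  FeaturesOr = (φ ψ : L) → Σ L λ χ → ⟦ χ ⟧ ≐ (⟦ φ ⟧ ∪ ⟦ ψ ⟧)

  Consistent : L → Set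
  Consistent φ = Satisfiable ⟦ φ ⟧

  IsCharacteristic : L → P → Set
  IsCharacteristic χ p = (q : P) → (q ∈ ⟦ χ ⟧ → Lof p ⊆ Lof q) × (Lof p ⊆ Lof q → q ∈ ⟦ χ ⟧)

  Decomposable : L → Set
  Decomposable φ =
    Σ P λ p → Σ L λ χ → Σ L λ ψ →
      IsCharacteristic χ p × p ∉ ⟦ ψ ⟧ × (⟦ φ ⟧ ≐ (⟦ χ ⟧ ∪ ⟦ ψ ⟧))

  LogicDecomposable : Set
  LogicDecomposable =
    (φ : L) → Consistent φ → Decomposable φ ⊎ (Σ P λ p → IsCharacteristic φ p)

{-# OPTIONS --safe #-}
-- Write p ≼ q for 𝓛(p) ⊆ 𝓛(q). Over a finite P, the conjunction of one formula
-- true at p with, for every q such that p ⋠ q, a formula true at p but not at q,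
-- is characteristic for p. Given a consistent φ, pick p ≼-minimal in ⟦φ⟧ and χ
-- characteristic for p, so ⟦χ⟧ ⊆ ⟦φ⟧. By minimality every r ∈ ⟦φ⟧ ∖ ⟦χ⟧ has
-- r ⋠ p, hence a formula true at r but not at p; the disjunction ψ of these
-- (each conjoined with φ) gives ⟦φ⟧ = ⟦χ⟧ ∪ ⟦ψ⟧ with p ∉ ⟦ψ⟧. If ⟦φ⟧ ∖ ⟦χ⟧ is
-- empty, φ is itself characteristic for p.
module Submission where

open import Defs
open import Level using (0ℓ)
open import Function using (_∘_)
open import Function.Bundles using (_↔_; Inverse)
open import Data.Nat using (ℕ; zero; suc)
open import Data.Fin using (Fin; zero; suc)
open import Data.Product using (Σ; ∃; _×_; _,_; proj₁; proj₂)
open import Data.Sum using (inj₁; inj₂; [_,_]; map₂)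
open import Data.Empty using (⊥-elim)
open import Relation.Nullary using (¬_; yes; no)
open import Relation.Nullary.Decidable using (toSum)
open import Relation.Unary
  using (Pred; _∈_; _∉_; _⊆_; _≐_; _∖_; ｛_｝; ⋂; ⋃; Satisfiable)
open import Relation.Unary.Properties using (≐-trans)
open import Relation.Binary using (Rel; Transitive)
open import Relation.Binary.PropositionalEquality using (refl; subst; sym)
open import Axiom.ExcludedMiddle using (ExcludedMiddle)
open import Axiom.DoubleNegationElimination using (DoubleNegationElimination; em⇒dne)

module _ {I J A : Set} (e : I ↔ J) where
  open Inverse e

  ⋂-reindex : (F : I → Pred A 0ℓ) → ⋂ J (F ∘ from) ≐ ⋂ I F
  ⋂-reindex F = (λ {x} h i → subst (λ k → F k x) (strictlyInverseʳ i) (h (to i)))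
              , (λ h j → h (from j))

  ⋃-reindex : (F : I → Pred A 0ℓ) → ⋃ J (F ∘ from) ≐ ⋃ I F
  ⋃-reindex F = (λ (j , h) → from j , h)
              , (λ {x} (i , h) → to i , subst (λ k → F k x) (sym (strictlyInverseʳ i)) h)

module _ {P L : Set} (⟦_⟧ : L → Pred P 0ℓ) where

  -- 𝓛 need not contain ⊤ or ⊥, so only non-empty conjunctions and disjunctions
  -- exist; this is also why certificates and covers below are padded.
  ⋀-Fin : FeaturesAnd ⟦_⟧ → ∀ {m} (f : Fin (suc m) → L) →
          Σ L λ χ → ⟦ χ ⟧ ≐ ⋂ (Fin (suc m)) (⟦_⟧ ∘ f)
  ⋀-Fin ∧ {zero} f = f zero , (λ h → λ { zero → h }) , (λ h → h zero)
  ⋀-Fin ∧ {suc m} f with ⋀-Fin ∧ (f ∘ suc)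
  ... | χ , χ⊆ , ⊆χ with ∧ (f zero) χ
  ...   | c , c⊆ , ⊆c =
    c , (λ h → λ { zero → proj₁ (c⊆ h) ; (suc i) → χ⊆ (proj₂ (c⊆ h)) i })
      , (λ h → ⊆c (h zero , ⊆χ (h ∘ suc)))

  ⋁-Fin : FeaturesOr ⟦_⟧ → ∀ {m} (f : Fin (suc m) → L) →
          Σ L λ ψ → ⟦ ψ ⟧ ≐ ⋃ (Fin (suc m)) (⟦_⟧ ∘ f)
  ⋁-Fin ∨ {zero} f = f zero , (λ h → zero , h) , (λ { (zero , h) → h })
  ⋁-Fin ∨ {suc m} f with ⋁-Fin ∨ (f ∘ suc)
  ... | ψ , ψ⊆ , ⊆ψ with ∨ (f zero) ψ
  ...   | d , d⊆ , ⊆d =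
    d , (λ h → [ (λ h₀ → zero , h₀) , (λ h′ → let i , hᵢ = ψ⊆ h′ in suc i , hᵢ) ] (d⊆ h))
      , (λ { (zero , h) → ⊆d (inj₁ h) ; (suc i , h) → ⊆d (inj₂ (⊆ψ (i , h))) })

  module _ {I : Set} {n : ℕ} (finite : I ↔ Fin (suc n)) where
    open Inverse finite using (from)

    ⋀-finite : FeaturesAnd ⟦_⟧ → (f : I → L) → Σ L λ χ → ⟦ χ ⟧ ≐ ⋂ I (⟦_⟧ ∘ f)
    ⋀-finite ∧ f with ⋀-Fin ∧ (f ∘ from)
    ... | χ , χ≐ = χ , ≐-trans χ≐ (⋂-reindex finite (⟦_⟧ ∘ f))

    ⋁-finite : FeaturesOr ⟦_⟧ → (f : I → L) → Σ L λ ψ → ⟦ ψ ⟧ ≐ ⋃ I (⟦_⟧ ∘ f)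
    ⋁-finite ∨ f with ⋁-Fin ∨ (f ∘ from)
    ... | ψ , ψ≐ = ψ , ≐-trans ψ≐ (⋃-reindex finite (⟦_⟧ ∘ f))

Minimal : {A : Set} → Rel A 0ℓ → Pred A 0ℓ → Pred A 0ℓ
Minimal _≼_ S p = p ∈ S × (∀ {q} → q ∈ S → q ≼ p → p ≼ q)

module _ (em : ExcludedMiddle 0ℓ) {A : Set} {_≼_ : Rel A 0ℓ} (≼-trans : Transitive _≼_)
         {S : Pred A 0ℓ} where

  minimal-among : ∀ {m} (h : Fin m → A) {a : A} → a ∈ S →
                  Σ A λ p → p ∈ S × (∀ i → h i ∈ S → h i ≼ p → p ≼ h i)
  minimal-among {zero} h a∈S = _ , a∈S , λ ()
  minimal-among {suc m} h a∈S with minimal-among (h ∘ suc) a∈S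
  ... | r , r∈S , r-min with em {h zero ∈ S × h zero ≼ r}
  ...   | yes (x∈S , x≼r) = h zero , x∈S , λ
    { zero    _   y≼x → y≼x
    ; (suc i) y∈S y≼x → ≼-trans x≼r (r-min i y∈S (≼-trans y≼x x≼r)) }
  ...   | no ¬x∈S×x≼r = r , r∈S , λ
    { zero    x∈S x≼r → ⊥-elim (¬x∈S×x≼r (x∈S , x≼r))
    ; (suc i)         → r-min i }

  minimal-element : ∀ {n} → A ↔ Fin (suc n) → Satisfiable S → Satisfiable (Minimal _≼_ S)
  minimal-element finite (a , a∈S) with minimal-among (Inverse.from finite) a∈S
  ... | p , p∈S , p-min = p , p∈S , λ {r} →
    subst (λ y → y ∈ S → y ≼ p → p ≼ y) (Inverse.strictlyInverseʳ finite r)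
          (p-min (Inverse.to finite r))

module _ (em : ExcludedMiddle 0ℓ) {P L : Set} (⟦_⟧ : L → Pred P 0ℓ) where

  private
    dne : DoubleNegationElimination 0ℓ
    dne = em⇒dne em

  _≼_ : Rel P 0ℓ
  p ≼ q = Lof ⟦_⟧ p ⊆ Lof ⟦_⟧ q

  ≼-trans : Transitive _≼_
  ≼-trans p≼q q≼r = q≼r ∘ p≼q

  separating-formula : ∀ {p q} → ¬ p ≼ q → ∃ λ φ → p ∈ ⟦ φ ⟧ × q ∉ ⟦ φ ⟧
  separating-formula p⋠q = dne λ ∄φ → p⋠q λ {φ} p∈φ → dne λ q∉φ → ∄φ (φ , p∈φ , q∉φ)

  characteristic⇒⊆ : ∀ {χ φ p} → IsCharacteristic ⟦_⟧ χ p → p ∈ ⟦ φ ⟧ → ⟦ χ ⟧ ⊆ ⟦ φ ⟧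
  characteristic⇒⊆ {p = p} χ-char p∈φ {q} q∈χ = proj₁ (χ-char q) q∈χ p∈φ

  ≼-certificate : ∀ {p φ₀} → p ∈ ⟦ φ₀ ⟧ → ∀ q → Σ L λ σ → p ∈ ⟦ σ ⟧ × (q ∈ ⟦ σ ⟧ → p ≼ q)
  ≼-certificate {p} {φ₀} p∈φ₀ q with em {p ≼ q}
  ... | yes p≼q = φ₀ , p∈φ₀ , λ _ → p≼q
  ... | no p⋠q with separating-formula p⋠q
  ...   | σ , p∈σ , q∉σ = σ , p∈σ , λ q∈σ → ⊥-elim (q∉σ q∈σ)

  IsCharacteristic-resp-≐ : ∀ {χ φ p} → ⟦ φ ⟧ ≐ ⟦ χ ⟧ →
                            IsCharacteristic ⟦_⟧ χ p → IsCharacteristic ⟦_⟧ φ p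
  IsCharacteristic-resp-≐ (φ⊆χ , χ⊆φ) χ-char q =
    (λ q∈φ → proj₁ (χ-char q) (φ⊆χ q∈φ)) , (λ p≼q → χ⊆φ (proj₂ (χ-char q) p≼q))

  separated-from-minimal : FeaturesAnd ⟦_⟧ → ∀ {φ χ p r} →
    Minimal _≼_ ⟦ φ ⟧ p → IsCharacteristic ⟦_⟧ χ p →
    r ∈ ⟦ φ ⟧ ∖ ⟦ χ ⟧ → ∃ λ σ → r ∈ ⟦ σ ⟧ × ⟦ σ ⟧ ⊆ ⟦ φ ⟧ ∖ ｛ p ｝
  separated-from-minimal ∧ {φ} {r = r} (_ , p-min) χ-char (r∈φ , r∉χ)
    with separating-formula {r} (λ r≼p → r∉χ (proj₂ (χ-char r) (p-min r∈φ r≼p)))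
  ... | θ , r∈θ , p∉θ with ∧ φ θ
  ...   | σ , σ⊆ , ⊆σ =
    σ , ⊆σ (r∈φ , r∈θ) , λ x∈σ → proj₁ (σ⊆ x∈σ) , λ { refl → p∉θ (proj₂ (σ⊆ x∈σ)) }

  module _ {n : ℕ} (finite : P ↔ Fin (suc n)) where

    characteristic-formula : FeaturesAnd ⟦_⟧ → ∀ {p φ₀} → p ∈ ⟦ φ₀ ⟧ →
                             ∃ λ χ → IsCharacteristic ⟦_⟧ χ p
    characteristic-formula ∧ {p} p∈φ₀ =
      let χ , χ⊆ , ⊆χ = ⋀-finite ⟦_⟧ finite ∧ (proj₁ ∘ certificate)
      in χ , λ q → (λ q∈χ → proj₂ (proj₂ (certificate q)) (χ⊆ q∈χ q))
                 , (λ p≼q → ⊆χ (λ r → p≼q (proj₁ (proj₂ (certificate r)))))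
      where
      certificate : ∀ q → Σ L λ σ → p ∈ ⟦ σ ⟧ × (q ∈ ⟦ σ ⟧ → p ≼ q)
      certificate = ≼-certificate p∈φ₀

    locally-covered⇒covered : FeaturesOr ⟦_⟧ → {S U : Pred P 0ℓ} → Satisfiable S →
      (∀ {r} → r ∈ S → ∃ λ σ → r ∈ ⟦ σ ⟧ × ⟦ σ ⟧ ⊆ U) →
      ∃ λ ψ → S ⊆ ⟦ ψ ⟧ × ⟦ ψ ⟧ ⊆ U
    locally-covered⇒covered ∨ {S} {U} (r₀ , r₀∈S) local =
      let ψ , ψ⊆ , ⊆ψ = ⋁-finite ⟦_⟧ finite ∨ (proj₁ ∘ padded)
      in ψ , (λ {r} r∈S → ⊆ψ (r , proj₂ (proj₂ (padded r)) r∈S))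
           , (λ x∈ψ → let r , x∈σᵣ = ψ⊆ x∈ψ in proj₁ (proj₂ (padded r)) x∈σᵣ)
      where
      padded : ∀ r → Σ L λ σ → ⟦ σ ⟧ ⊆ U × (r ∈ S → r ∈ ⟦ σ ⟧)
      padded r with em {r ∈ S}
      ... | yes r∈S = let σ , r∈σ , σ⊆U = local r∈S in σ , σ⊆U , λ _ → r∈σ
      ... | no r∉S = let σ , _ , σ⊆U = local r₀∈S in σ , σ⊆U , λ r∈S → ⊥-elim (r∉S r∈S)

    decomposition : FeaturesAnd ⟦_⟧ → FeaturesOr ⟦_⟧ → ∀ {φ χ p} →
      Minimal _≼_ ⟦ φ ⟧ p → IsCharacteristic ⟦_⟧ χ p →
      Satisfiable (⟦ φ ⟧ ∖ ⟦ χ ⟧) → Decomposable ⟦_⟧ φ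
    decomposition ∧ ∨ {φ} {χ} {p} p-min@(p∈φ , _) χ-char ∃r
      with locally-covered⇒covered ∨ ∃r (separated-from-minimal ∧ p-min χ-char)
    ... | ψ , ⊆ψ , ψ⊆ = p , χ , ψ , χ-char , (λ p∈ψ → proj₂ (ψ⊆ p∈ψ) refl)
                      , (λ x∈φ → map₂ (λ x∉χ → ⊆ψ (x∈φ , x∉χ)) (toSum em))
                      , [ characteristic⇒⊆ χ-char p∈φ , proj₁ ∘ ψ⊆ ]

    logic-decomposable : FeaturesAnd ⟦_⟧ → FeaturesOr ⟦_⟧ → LogicDecomposable ⟦_⟧
    logic-decomposable ∧ ∨ φ consistent with minimal-element em ≼-trans finite consistent
    ... | p , p-min@(p∈φ , _) with characteristic-formula ∧ p∈φ
    ... | χ , χ-char with em {Satisfiable (⟦ φ ⟧ ∖ ⟦ χ ⟧)}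
    ... | yes ∃r = inj₁ (decomposition ∧ ∨ p-min χ-char ∃r)
    ... | no ∄r = inj₂ (p , IsCharacteristic-resp-≐ (φ⊆χ , characteristic⇒⊆ χ-char p∈φ) χ-char)
      where
      φ⊆χ : ⟦ φ ⟧ ⊆ ⟦ χ ⟧
      φ⊆χ x∈φ = dne λ x∉χ → ∄r (_ , x∈φ , x∉χ)

mainTheorem18 : ExcludedMiddle 0ℓ →
    (P : Set) (n : ℕ) → P ↔ Fin (suc n) →
    (L : Set) (⟦_⟧ : L → Pred P 0ℓ) →
    ((p : P) → ∃ λ φ → Lof ⟦_⟧ p φ) →
    FeaturesAnd ⟦_⟧ → FeaturesOr ⟦_⟧ →
    LogicDecomposable ⟦_⟧
mainTheorem18 em P n finite L ⟦_⟧ _ = logic-decomposable em ⟦_⟧ finite
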